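{- Let $\mathcal{G}$ be a finite additive abelian group of order $n$. There does not exist an $(n,m,k;1)$-strong external difference family in $\mathcal{G}$ with $m\ge 3$ and $k>1$.
   Context: For disjoint subsets $A,B$ of an additive abelian group $\mathcal{G}$, $\mathcal{D}(A,B)$ denotes the multiset $\{x-y : x\in A, y\in B\}$. An $(n,m,k;\lambda)$-strong external difference family (SEDF) in an additive abelian group $\mathcal{G}$ of order $n$ is a collection of $m$ pairwise disjoint $k$-subsets $A_1,\dots,A_m$ of $\mathcal{G}$ such that for every $i$, $1\le i\le m$, the multiset equation $\bigcup_{j\ne i}\mathcal{D}(A_i,A_j)=\lambda(\mathcal{G}\setminus\{0\})$ holds, i.e. every nonzero element of $\mathcal{G}$ occurs exactly $\lambda$ times as a difference $x-y$ with $x\in A_i$, $y\in A_j$, $j\neq i$. -}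

module Defs where

open import Level using (Level; _⊔_)
open import Algebra.Bundles using (AbelianGroup)
open import Data.Nat using (ℕ; zero; suc; _+_)
open import Data.Fin using (Fin; zero; suc)
import Data.Fin as F
open import Data.Product using (Σ; _×_; _,_)
open import Relation.Nullary using (¬_; Dec; yes; no)
open import Relation.Binary.PropositionalEquality using (_≡_)

sumFin : ∀ {n} → (Fin n → ℕ) → ℕ
sumFin {zero}  f = 0
sumFin {suc n} f = f zero + sumFin (λ i → f (suc i))

module _ {c ℓ : Level} (G : AbelianGroup c ℓ) where
  open AbelianGroup G
  -- NOTE: stdlib writes abelian groups multiplicatively; the paper's
  -- additive x - y is  x ∙ y ⁻¹ , and the paper's 0 is ε.

  -- We also require ≈ to be decidable,
  -- so that multiplicities of differences can be counted.
  record FiniteOfOrder (n : ℕ) : Set (c ⊔ ℓ) where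
    field
      _≟_       : (x y : Carrier) → Dec (x ≈ y)
      enum      : Fin n → Carrier
      enum-inj  : ∀ i j → enum i ≈ enum j → i ≡ j
      enum-surj : ∀ x → Σ (Fin n) (λ i → enum i ≈ x)

  module _ {n : ℕ} (fin : FiniteOfOrder n) where
    open FiniteOfOrder fin

    diffIndicator : ∀ {m} (i j : Fin m) (x y g : Carrier) → ℕ
    diffIndicator i j x y g with i F.≟ j | (x ∙ y ⁻¹) ≟ g
    ... | yes _ | _     = 0
    ... | no _  | yes _ = 1
    ... | no _  | no _  = 0

    -- Multiplicity of g in the multiset  ⋃_{j ≠ i} D(A_i, A_j).
    extDiffCount : ∀ {m k} (A : Fin m → Fin k → Carrier) (i : Fin m) (g : Carrier) → ℕ
    extDiffCount A i g =
      sumFin (λ j → sumFin (λ a → sumFin (λ b → diffIndicator i j (A i a) (A j b) g)))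

    -- Each A i is a k-subset (no repetitions) and the
    -- sets are pairwise disjoint: together, (i , a) ↦ A i a is injective.
    record IsSEDF (m k lam : ℕ) (A : Fin m → Fin k → Carrier) : Set (c ⊔ ℓ) where
      field
        injective  : ∀ i j a b → A i a ≈ A j b → (i ≡ j × a ≡ b)
        difference : ∀ (i : Fin m) (g : Carrier) → ¬ (g ≈ ε) → extDiffCount A i g ≡ lam

-- With λ = 1 every nonzero element is an external difference from each block in
-- exactly one way.  Take two elements u ≠ v of a block A₀ and let d = u − v.
-- Seen from any other block Aᵢ, the unique representation d = x − y (x ∈ Aᵢ)
-- must have y ∈ A₀: if y ∈ Aⱼ with j ≠ 0, then u − x = v − y would be
-- represented twice from A₀.  With two further blocks A₁, A₂ this gives
-- x₁ − y₁ = d = x₂ − y₂ with y₁, y₂ ∈ A₀, so y₁ − x₁ = y₂ − x₂ is represented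
-- from A₀ once against A₁ and once against A₂.
module Submission where

open import Defs
open import Level using (Level)
open import Algebra.Bundles using (AbelianGroup; Group)
open import Data.Nat using (ℕ; suc; _≤_; _<_; _≥_; _>_; s≤s; z≤n; _+_)
open import Data.Nat.Properties using (≤-trans; ≤-reflexive; +-mono-≤; m≤m+n; m≤n+m)
open import Data.Fin using (Fin; zero; suc)
import Data.Fin as F
open import Data.Product using (∃-syntax; _×_; _,_; proj₁; proj₂)
open import Data.Empty using (⊥; ⊥-elim)
open import Function using (_∘_)
open import Relation.Nullary using (¬_; yes; no)
open import Relation.Binary.PropositionalEquality as ≡ using (_≡_; _≢_; ≢-sym; refl; cong)
import Algebra.Properties.AbelianGroup as AbelianGroupProperties
import Relation.Binary.Reasoning.Setoid as SetoidReasoning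

sumFin-lower : ∀ {n} (f : Fin n → ℕ) i → f i ≤ sumFin f
sumFin-lower f zero    = m≤m+n _ _
sumFin-lower f (suc i) = ≤-trans (sumFin-lower (λ j → f (suc j)) i) (m≤n+m _ _)

sumFin-pos : ∀ {n} (f : Fin n → ℕ) i → 0 < f i → 0 < sumFin f
sumFin-pos f i 0<fi = ≤-trans 0<fi (sumFin-lower f i)

sumFin-pos⇒∃-pos : ∀ {n} (f : Fin n → ℕ) → 0 < sumFin f → ∃[ i ] 0 < f i
sumFin-pos⇒∃-pos {suc n} f 0<Σf with f zero in fzero≡
... | suc _ = zero , ≡.subst (0 <_) (≡.sym fzero≡) (s≤s z≤n)
... | 0 with sumFin-pos⇒∃-pos (λ j → f (suc j)) 0<Σf
...   | i , 0<fi = suc i , 0<fi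

pos+pos≰1 : ∀ {a b} → 0 < a → 0 < b → ¬ (a + b ≤ 1)
pos+pos≰1 0<a 0<b a+b≤1 with ≤-trans (+-mono-≤ 0<a 0<b) a+b≤1
... | s≤s ()

sumFin≤1⇒pos-unique : ∀ {n} (f : Fin n → ℕ) {i j} →
                      sumFin f ≤ 1 → 0 < f i → 0 < f j → i ≡ j
sumFin≤1⇒pos-unique f {zero}  {zero}  _    _    _    = refl
sumFin≤1⇒pos-unique f {zero}  {suc j} Σf≤1 0<fi 0<fj =
  ⊥-elim (pos+pos≰1 0<fi (sumFin-pos (λ j → f (suc j)) j 0<fj) Σf≤1)
sumFin≤1⇒pos-unique f {suc i} {zero}  Σf≤1 0<fi 0<fj =
  ⊥-elim (pos+pos≰1 0<fj (sumFin-pos (λ j → f (suc j)) i 0<fi) Σf≤1)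
sumFin≤1⇒pos-unique f {suc i} {suc j} Σf≤1 0<fi 0<fj =
  cong suc (sumFin≤1⇒pos-unique (λ j → f (suc j)) (≤-trans (m≤n+m _ _) Σf≤1) 0<fi 0<fj)

sumFin²≤1⇒pos-unique : ∀ {m n} (g : Fin m → Fin n → ℕ) {i i' x x'} →
                       sumFin (λ i → sumFin (g i)) ≤ 1 → 0 < g i x → 0 < g i' x' →
                       i ≡ i' × x ≡ x'
sumFin²≤1⇒pos-unique g {i} {x = x} {x'} ΣΣg≤1 0<gix 0<gi'x'
  with sumFin≤1⇒pos-unique (λ i → sumFin (g i)) ΣΣg≤1
         (sumFin-pos (g i) _ 0<gix) (sumFin-pos (g _) _ 0<gi'x')
... | refl = refl , sumFin≤1⇒pos-unique (g i) Σgi≤1 0<gix 0<gi'x'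
  where
  Σgi≤1 : sumFin (g i) ≤ 1
  Σgi≤1 = ≤-trans (sumFin-lower (λ i → sumFin (g i)) i) ΣΣg≤1

module _ {c ℓ : Level} (G : AbelianGroup c ℓ) where
  open AbelianGroup G renaming (refl to ≈-refl)
  open Group group using (_//_)
  open AbelianGroupProperties G using (xyx⁻¹≈y; ⁻¹-anti-homo-//; x∙y⁻¹≈ε⇒x≈y)
  open SetoidReasoning setoid

  //-exchange : ∀ x x' y w → x // x' ≈ y // w → x // y ≈ x' // w
  //-exchange x x' y w x-x'≈y-w = begin
    x ∙ y ⁻¹                ≈⟨ ∙-congʳ x≈x-x'+x' ⟩
    x ∙ x' ⁻¹ ∙ x' ∙ y ⁻¹   ≈⟨ ∙-congʳ (∙-congʳ x-x'≈y-w) ⟩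
    y ∙ w ⁻¹ ∙ x' ∙ y ⁻¹    ≈⟨ ∙-congʳ (assoc _ _ _) ⟩
    y ∙ (w ⁻¹ ∙ x') ∙ y ⁻¹  ≈⟨ xyx⁻¹≈y y _ ⟩
    w ⁻¹ ∙ x'               ≈⟨ comm _ _ ⟩
    x' ∙ w ⁻¹               ∎
    where
    x≈x-x'+x' : x ≈ x ∙ x' ⁻¹ ∙ x'
    x≈x-x'+x' = sym (begin
      x ∙ x' ⁻¹ ∙ x'    ≈⟨ assoc _ _ _ ⟩
      x ∙ (x' ⁻¹ ∙ x')  ≈⟨ ∙-congˡ (inverseˡ x') ⟩
      x ∙ ε             ≈⟨ identityʳ x ⟩
      x                 ∎)

  //-flip : ∀ {y w z v} → y // w ≈ z // v → w // y ≈ v // z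
  //-flip {y} {w} {z} {v} y-w≈z-v = begin
    w // y       ≈⟨ ⁻¹-anti-homo-// y w ⟨
    (y // w) ⁻¹  ≈⟨ ⁻¹-cong y-w≈z-v ⟩
    (z // v) ⁻¹  ≈⟨ ⁻¹-anti-homo-// z v ⟩
    v // z       ∎

  module _ {n : ℕ} (fin : FiniteOfOrder G n) where
    open FiniteOfOrder fin using (_≟_)

    diffIndicator-pos⇒ : ∀ {m} (i j : Fin m) x y g →
                         0 < diffIndicator G fin i j x y g → i ≢ j × x // y ≈ g
    diffIndicator-pos⇒ i j x y g 0<δ with i F.≟ j | (x // y) ≟ g
    ... | no i≢j | yes x-y≈g = i≢j , x-y≈g

    ⇒diffIndicator-pos : ∀ {m} (i j : Fin m) x y g →
                         i ≢ j → x // y ≈ g → 0 < diffIndicator G fin i j x y g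
    ⇒diffIndicator-pos i j x y g i≢j x-y≈g with i F.≟ j | (x // y) ≟ g
    ... | yes i≡j | _          = ⊥-elim (i≢j i≡j)
    ... | no _    | yes _      = s≤s z≤n
    ... | no _    | no x-y≉g   = ⊥-elim (x-y≉g x-y≈g)

    module _ {m k : ℕ} {A : Fin m → Fin k → Carrier} (sedf : IsSEDF G fin m k 1 A) where
      open IsSEDF sedf

      A-diff≉ε : ∀ {i j a b} → ¬ (i ≡ j × a ≡ b) → ¬ (A i a // A j b ≈ ε)
      A-diff≉ε ia≢jb Aia-Ajb≈ε = ia≢jb (injective _ _ _ _ (x∙y⁻¹≈ε⇒x≈y _ _ Aia-Ajb≈ε))

      external-rep-exists : ∀ i {g} → ¬ (g ≈ ε) →
                            ∃[ j ] ∃[ a ] ∃[ b ] (i ≢ j × A i a // A j b ≈ g)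
      external-rep-exists i {g} g≉ε
        with sumFin-pos⇒∃-pos _ (≤-reflexive (≡.sym (difference i g g≉ε)))
      ... | j , 0<Σj with sumFin-pos⇒∃-pos _ 0<Σj
      ... | a , 0<Σa with sumFin-pos⇒∃-pos _ 0<Σa
      ... | b , 0<δ = j , a , b , diffIndicator-pos⇒ i j _ _ g 0<δ

      external-rep-unique : ∀ {i g j j' a a' b b'} → ¬ (g ≈ ε) →
                            i ≢ j  → A i a  // A j  b  ≈ g →
                            i ≢ j' → A i a' // A j' b' ≈ g →
                            j ≡ j' × a ≡ a'
      external-rep-unique {i} {g} {j} {j'} {a} {a'} {b} {b'} g≉ε i≢j e i≢j' e' =
        sumFin²≤1⇒pos-unique (λ j a → sumFin (δ j a)) (≤-reflexive (difference i g g≉ε))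
          (sumFin-pos (δ j a) b (⇒diffIndicator-pos i j _ _ g i≢j e))
          (sumFin-pos (δ j' a') b' (⇒diffIndicator-pos i j' _ _ g i≢j' e'))
        where
        δ : Fin m → Fin k → Fin k → ℕ
        δ j a b = diffIndicator G fin i j (A i a) (A j b) g

      module _ {i₀ : Fin m} {u v : Fin k} (u≢v : u ≢ v) where
        internal-diff-rep : ∀ {i} → i ≢ i₀ → ∃[ a ] ∃[ b ] (A i a // A i₀ b ≈ A i₀ u // A i₀ v)
        internal-diff-rep {i} i≢i₀ with external-rep-exists i (A-diff≉ε (u≢v ∘ proj₂))
        ... | j , a , b , i≢j , Aia-Ajb≈u-v with j F.≟ i₀
        ...   | yes refl = a , b , Aia-Ajb≈u-v
        ...   | no j≢i₀  = ⊥-elim (u≢v (proj₂ (external-rep-unique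
                  (A-diff≉ε (≢-sym i≢i₀ ∘ proj₁))
                  (≢-sym i≢i₀) ≈-refl
                  (≢-sym j≢i₀) (sym (//-exchange _ _ _ _ (sym Aia-Ajb≈u-v))))))

        no-three-blocks : ∀ {i₁ i₂} → i₁ ≢ i₀ → i₂ ≢ i₀ → i₁ ≢ i₂ → ⊥
        no-three-blocks i₁≢i₀ i₂≢i₀ i₁≢i₂
          with internal-diff-rep i₁≢i₀ | internal-diff-rep i₂≢i₀
        ... | a₁ , b₁ , e₁ | a₂ , b₂ , e₂ = i₁≢i₂ (proj₁ (external-rep-unique
                (A-diff≉ε (≢-sym i₁≢i₀ ∘ proj₁))
                (≢-sym i₁≢i₀) ≈-refl
                (≢-sym i₂≢i₀) (sym (//-flip (trans e₁ (sym e₂))))))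

mainTheorem1 : ∀ {c ℓ : Level} (G : AbelianGroup c ℓ) (n : ℕ) (fin : FiniteOfOrder G n)
                 (m k : ℕ) → m ≥ 3 → k > 1 →
                 (A : Fin m → Fin k → AbelianGroup.Carrier G) →
                 ¬ IsSEDF G fin m k 1 A
mainTheorem1 G n fin (suc (suc (suc _))) (suc (suc _)) (s≤s (s≤s (s≤s _))) (s≤s (s≤s _)) A sedf =
  no-three-blocks G fin sedf {i₀ = zero} {u = zero} {v = suc zero} (λ ())
    {i₁ = suc zero} {i₂ = suc (suc zero)} (λ ()) (λ ()) (λ ())
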